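{- The following two statements are equivalent: (a) Every 2-connected cubic graph $G$ admits a proper $5$-edge-coloring $c$ such that $|N_G(c)|\leq 5$. (b) There exists a sublinear function $f:\mathbb{N}\rightarrow\mathbb{N}$ such that every 2-connected cubic graph $G$ admits a proper $5$-edge-coloring $c$ with $|N_G(c)|\leq f(|V(G)|)$.
   Context: Graphs are finite, undirected, loopless, and may have parallel edges. A function $f:\mathbb{N}\to\mathbb{N}$ is sublinear if $\lim_{n\to+\infty} f(n)/n=0$. A proper $5$-edge-coloring assigns colors from $\{1,\dots,5\}$ to edges so that adjacent edges get different colors. For an edge-coloring $c$, $S_c(v)$ is the set of colors on edges incident to $v$. An edge $uv$ of a cubic graph is poor if $|S_c(u)\cup S_c(v)|=3$, rich if $|S_c(u)\cup S_c(v)|=5$, and abnormal otherwise. $N_G(c)$ is the set of abnormal edges of $G$ with respect to $c$. -}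

module Defs where

open import Data.Nat using (ℕ; zero; suc; _+_; _*_; _≤_)
open import Data.Fin using (Fin; _≟_)
open import Data.Fin.Properties using (any?)
open import Data.Fin.Subset using (Subset; _∪_; ∣_∣)
open import Data.Vec using (tabulate)
open import Data.List using (List; map; allFin)
open import Data.Nat.ListAction using (sum)
open import Data.Unit using (⊤)
open import Data.Bool using (Bool; if_then_else_)
open import Data.Product using (_×_; _,_; proj₁; proj₂; Σ; ∃-syntax)
open import Data.Sum using (_⊎_)
open import Relation.Nullary using (¬_; Dec; yes; no; does; ¬?)
open import Relation.Nullary.Decidable using (_×-dec_; _⊎-dec_)
open import Data.Nat.Properties using () renaming (_≟_ to _≟ℕ_)
open import Relation.Binary.PropositionalEquality using (_≡_; _≢_)

-- A finite loopless multigraph: vertices Fin n, edges Fin m,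
-- each edge has an (ordered, but irrelevant) pair of distinct endpoints.
record Graph : Set where
  field
    n        : ℕ
    m        : ℕ
    ends     : Fin m → Fin n × Fin n
    loopless : ∀ e → proj₁ (ends e) ≢ proj₂ (ends e)

open Graph public

∣V∣ : Graph → ℕ
∣V∣ G = n G

Incident : (G : Graph) → Fin (m G) → Fin (n G) → Set
Incident G e v = proj₁ (ends G e) ≡ v ⊎ proj₂ (ends G e) ≡ v

Joins : (G : Graph) → Fin (m G) → Fin (n G) → Fin (n G) → Set
Joins G e u w = (proj₁ (ends G e) ≡ u × proj₂ (ends G e) ≡ w)
              ⊎ (proj₁ (ends G e) ≡ w × proj₂ (ends G e) ≡ u)

ind : ∀ {p} {P : Set p} → Dec P → ℕ
ind d = if does d then 1 else 0

degree : (G : Graph) → Fin (n G) → ℕ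
degree G v = sum (map (λ e → ind (proj₁ (ends G e) ≟ v) + ind (proj₂ (ends G e) ≟ v))
                      (allFin (m G)))

Cubic : Graph → Set
Cubic G = ∀ v → degree G v ≡ 3

data Walk (G : Graph) (ok : Fin (n G) → Set) : Fin (n G) → Fin (n G) → Set where
  here : ∀ {u} → ok u → Walk G ok u u
  step : ∀ {u w v} (e : Fin (m G)) → Joins G e u w → ok u → Walk G ok w v → Walk G ok u v

Connected : Graph → Set
Connected G = ∀ u v → Walk G (λ _ → ⊤) u v

ConnectedWithout : (G : Graph) → Fin (n G) → Set
ConnectedWithout G x = ∀ u v → u ≢ x → v ≢ x → Walk G (λ w → w ≢ x) u v

TwoConnected : Graph → Set
TwoConnected G = Connected G × (∀ x → ConnectedWithout G x)

EdgeColoring5 : Graph → Set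
EdgeColoring5 G = Fin (m G) → Fin 5

Proper : (G : Graph) → EdgeColoring5 G → Set
Proper G c = ∀ e f v → e ≢ f → Incident G e v → Incident G f v → c e ≢ c f

S : (G : Graph) → EdgeColoring5 G → Fin (n G) → Subset 5
S G c v = tabulate (λ k → does (any? (λ e →
            ((proj₁ (ends G e) ≟ v) ⊎-dec (proj₂ (ends G e) ≟ v)) ×-dec (c e ≟ k))))

unionSize : (G : Graph) → EdgeColoring5 G → Fin (m G) → ℕ
unionSize G c e = ∣ S G c (proj₁ (ends G e)) ∪ S G c (proj₂ (ends G e)) ∣

Poor Rich Abnormal : (G : Graph) → EdgeColoring5 G → Fin (m G) → Set
Poor G c e = unionSize G c e ≡ 3
Rich G c e = unionSize G c e ≡ 5
Abnormal G c e = ¬ Poor G c e × ¬ Rich G c e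

numAbnormal : (G : Graph) → EdgeColoring5 G → ℕ
numAbnormal G c = sum (map (λ e → ind ((¬? (unionSize G c e ≟ℕ 3)) ×-dec (¬? (unionSize G c e ≟ℕ 5))))
                           (allFin (m G)))

-- f(n)/n → 0, written with ε = 1/(k+1)
Sublinear : (ℕ → ℕ) → Set
Sublinear f = ∀ k → ∃[ N ] (∀ x → N ≤ x → suc k * f x ≤ x)

-- (a) ⇒ (b) takes f ≡ 5.  For (b) ⇒ (a), fix an edge e₀ = u₀v₀ of G and arrange k copies of
-- G − e₀ in a ring, joining u₀ of each copy to v₀ of the next.  The ring is again cubic and
-- 2-connected, with k·|V(G)| vertices, so for k large the sublinear bound gives it a proper
-- colouring with fewer than k abnormal edges, and some copy has no abnormal edge avoiding u₀ and v₀.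
-- Restrict that colouring to this copy and give e₀ a colour missing from the at most four other
-- edges at u₀ and v₀: every edge avoiding u₀ and v₀ keeps its colour sets and stays normal, so at
-- most e₀ and those four edges are abnormal.
module Submission where

open import Defs
open import Data.Bool using (if_then_else_)
open import Data.Empty using (⊥-elim)
open import Data.Fin using (Fin; zero; suc; toℕ; combine; remQuot; _↑ˡ_; _↑ʳ_; _≟_)
open import Data.Fin.Properties
  using (any?; all?; ¬∀⟶∃¬; suc-injective; toℕ-fromℕ<; toℕ-injective; toℕ<n;
         combine-injective; combine-injectiveˡ; combine-remQuot; remQuot-combine)
open import Data.Fin.Subset using (_∪_; ∣_∣)
open import Data.List using (allFin; map; tabulate)
open import Data.List.Properties using (map-tabulate)
import Data.Nat.ListAction as List
open import Data.Nat using (ℕ; zero; suc; _+_; _*_; _∸_; _≤_; _<_; _%_; _≤?_; z≤n; s≤s; z<s)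
open import Data.Nat.DivMod using (_mod_; m%n<n; %-distribˡ-+; m%n%n≡m%n; [m+n]%n≡m%n; m<n⇒m%n≡m; n%n≡0)
open import Data.Nat.Properties
  using (+-*-semiring; +-identityʳ; +-assoc; +-comm; *-comm; +-cancelˡ-≡; +-mono-≤; *-monoʳ-≤; *-monoʳ-<;
         ≤-refl; ≤-reflexive; ≤-trans; ≤-<-trans; <-trans; <⇒≤; <⇒≱; ≰⇒>; n≮n; n<1⇒n≡0;
         n≤1+n; n<1+n; m≤m+n; m≤n+m; m≤m*n; m+[n∸m]≡n; module ≤-Reasoning)
  renaming (_≟_ to _≟ℕ_)
open import Algebra.Properties.Semiring.Sum +-*-semiring
  using (sum; sum-syntax; ∑-comm; ∑-distrib-+; *-distribʳ-sum)
open import Data.Product using (_×_; _,_; proj₁; proj₂; ∃-syntax; uncurry)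
open import Data.Sum using (_⊎_; inj₁; inj₂)
open import Data.Unit using (⊤; tt)
open import Data.Vec.Properties using (tabulate-cong)
open import Function using (_∘_; id; Injective)
open import Function.Bundles using (_⇔_; mk⇔)
open import Relation.Binary.PropositionalEquality
open import Relation.Nullary using (¬_; Dec; yes; no; does; ¬?)
open import Relation.Nullary.Decidable using (_×-dec_; _⊎-dec_; decidable-stable)

ind-true : ∀ {P : Set} (p? : Dec P) → P → ind p? ≡ 1
ind-true (yes _) _ = refl
ind-true (no ¬p) p = ⊥-elim (¬p p)

ind-false : ∀ {P : Set} (p? : Dec P) → ¬ P → ind p? ≡ 0
ind-false (yes p) ¬p = ⊥-elim (¬p p)
ind-false (no _) _ = refl

ind≤1 : ∀ {P : Set} (p? : Dec P) → ind p? ≤ 1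
ind≤1 (yes _) = s≤s z≤n
ind≤1 (no _) = z≤n

ind-pos : ∀ {P : Set} (p? : Dec P) → 1 ≤ ind p? → P
ind-pos (yes p) _ = p

does-cong : ∀ {P Q : Set} (p? : Dec P) (q? : Dec Q) → (P → Q) → (Q → P) → does p? ≡ does q?
does-cong (yes _) (yes _) _ _ = refl
does-cong (yes p) (no ¬q) f _ = ⊥-elim (¬q (f p))
does-cong (no ¬p) (yes q) _ g = ⊥-elim (¬p (g q))
does-cong (no _) (no _) _ _ = refl

ind-cong : ∀ {P Q : Set} (p? : Dec P) (q? : Dec Q) → (P → Q) → (Q → P) → ind p? ≡ ind q?
ind-cong p? q? f g = cong (λ b → if b then 1 else 0) (does-cong p? q? f g)

ind-× : ∀ {P Q : Set} (p? : Dec P) (q? : Dec Q) → ind (p? ×-dec q?) ≡ ind p? * ind q?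
ind-× (yes _) (yes _) = refl
ind-× (yes _) (no _) = refl
ind-× (no _) _ = refl

sum-allFin : ∀ {m} (g : Fin m → ℕ) → List.sum (map g (allFin m)) ≡ sum g
sum-allFin g = trans (cong List.sum (map-tabulate id g)) (sum-tabulate g)
  where
  sum-tabulate : ∀ {m} (g : Fin m → ℕ) → List.sum (tabulate g) ≡ sum g
  sum-tabulate {zero} g = refl
  sum-tabulate {suc m} g = cong (g zero +_) (sum-tabulate (g ∘ suc))

∑-cong : ∀ {m} {g h : Fin m → ℕ} → (∀ i → g i ≡ h i) → sum g ≡ sum h
∑-cong {zero} _ = refl
∑-cong {suc m} g≡h = cong₂ _+_ (g≡h zero) (∑-cong (g≡h ∘ suc))

∑-mono-≤ : ∀ {m} {g h : Fin m → ℕ} → (∀ i → g i ≤ h i) → sum g ≤ sum h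
∑-mono-≤ {zero} _ = z≤n
∑-mono-≤ {suc m} g≤h = +-mono-≤ (g≤h zero) (∑-mono-≤ (g≤h ∘ suc))

∑-const-1 : ∀ m → ∑[ i < m ] 1 ≡ m
∑-const-1 zero = refl
∑-const-1 (suc m) = cong suc (∑-const-1 m)

∑-zero : ∀ {m} (g : Fin m → ℕ) → (∀ i → g i ≡ 0) → sum g ≡ 0
∑-zero {zero} _ _ = refl
∑-zero {suc m} g g≡0 = cong₂ _+_ (g≡0 zero) (∑-zero (g ∘ suc) (g≡0 ∘ suc))

∑-pos : ∀ {m} (g : Fin m → ℕ) → 1 ≤ sum g → ∃[ i ] 1 ≤ g i
∑-pos {suc m} g 1≤ with g zero in eq
... | suc _ = zero , subst (1 ≤_) (sym eq) (s≤s z≤n)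
... | zero with ∑-pos (g ∘ suc) 1≤
...   | i , 1≤gi = suc i , 1≤gi

∑-↑ : ∀ a b (g : Fin (a + b) → ℕ) → sum g ≡ ∑[ i < a ] g (i ↑ˡ b) + ∑[ j < b ] g (a ↑ʳ j)
∑-↑ zero b g = refl
∑-↑ (suc a) b g = trans (cong (g zero +_) (∑-↑ a b (g ∘ suc))) (sym (+-assoc (g zero) _ _))

∑-combine : ∀ a b (g : Fin (a * b) → ℕ) → sum g ≡ ∑[ i < a ] ∑[ j < b ] g (combine i j)
∑-combine zero b g = refl
∑-combine (suc a) b g =
  trans (∑-↑ b (a * b) g) (cong (∑[ j < b ] g (j ↑ˡ (a * b)) +_) (∑-combine a b (g ∘ (b ↑ʳ_))))

∑-ind-≡ : ∀ {m} (t : Fin m) → ∑[ j < m ] ind (j ≟ t) ≡ 1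
∑-ind-≡ {suc m} zero = cong suc (∑-zero {m} _ (λ j → ind-false (suc j ≟ zero) λ ()))
∑-ind-≡ {suc m} (suc t) =
  trans (∑-cong (λ j → ind-cong (suc j ≟ suc t) (j ≟ t) suc-injective (cong suc))) (∑-ind-≡ t)

-- Double counting: Σ_e h e ≥ Σ_e |φ⁻¹(e)| = a.
injection⇒≤∑ : ∀ {a m} (h : Fin m → ℕ) (φ : Fin a → Fin m) → Injective _≡_ _≡_ φ →
               (∀ t → 1 ≤ h (φ t)) → a ≤ sum h
injection⇒≤∑ {a} {m} h φ φ-inj pos = begin
  a                                     ≡⟨ sym (∑-const-1 a) ⟩
  ∑[ t < a ] 1                          ≡⟨ sym (∑-cong (λ t → ∑-ind-≡ (φ t))) ⟩
  ∑[ t < a ] ∑[ e < m ] ind (e ≟ φ t)   ≡⟨ ∑-comm (λ t e → ind (e ≟ φ t)) ⟩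
  ∑[ e < m ] ∑[ t < a ] ind (e ≟ φ t)   ≤⟨ ∑-mono-≤ fibre≤ ⟩
  sum h                                 ∎
  where
  open ≤-Reasoning
  fibre≤ : ∀ e → ∑[ t < a ] ind (e ≟ φ t) ≤ h e
  fibre≤ e with any? (λ t → φ t ≟ e)
  ... | yes (t₀ , refl) = ≤-trans (≤-reflexive fibre≡1) (pos t₀)
    where
    fibre≡1 : ∑[ t < a ] ind (φ t₀ ≟ φ t) ≡ 1
    fibre≡1 = trans (∑-cong λ t → ind-cong (φ t₀ ≟ φ t) (t ≟ t₀) (sym ∘ φ-inj) (cong φ ∘ sym)) (∑-ind-≡ t₀)
  ... | no ∄t = subst (_≤ h e) (sym (∑-zero _ (λ t → ind-false (e ≟ φ t) (λ eq → ∄t (t , sym eq))))) z≤n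

module Cyclic (K : ℕ) where
  k : ℕ
  k = suc K

  infixl 6 _⊕_
  _⊕_ : Fin k → ℕ → Fin k
  i ⊕ d = (toℕ i + d) mod k

  next prev : Fin k → Fin k
  next i = i ⊕ 1
  prev i = i ⊕ K

  toℕ-⊕ : ∀ i d → toℕ (i ⊕ d) ≡ (toℕ i + d) % k
  toℕ-⊕ i d = toℕ-fromℕ< (m%n<n (toℕ i + d) k)

  ⊕-cong-% : ∀ i d j e → (toℕ i + d) % k ≡ (toℕ j + e) % k → i ⊕ d ≡ j ⊕ e
  ⊕-cong-% i d j e eq = toℕ-injective (trans (toℕ-⊕ i d) (trans eq (sym (toℕ-⊕ j e))))

  toℕ-zero⊕ : ∀ {d} → d < k → toℕ (zero ⊕ d) ≡ d
  toℕ-zero⊕ {d} d<k = trans (toℕ-⊕ zero d) (m<n⇒m%n≡m d<k)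

  zero⊕toℕ : ∀ i → zero ⊕ toℕ i ≡ i
  zero⊕toℕ i = toℕ-injective (toℕ-zero⊕ (toℕ<n i))

  ⊕-identityʳ : ∀ i → i ⊕ 0 ≡ i
  ⊕-identityʳ i = trans (⊕-cong-% i 0 zero (toℕ i) (cong (_% k) (+-identityʳ (toℕ i)))) (zero⊕toℕ i)

  ⊕-% : ∀ i d → i ⊕ (d % k) ≡ i ⊕ d
  ⊕-% i d = ⊕-cong-% i (d % k) i d (begin
    (toℕ i + d % k) % k           ≡⟨ %-distribˡ-+ (toℕ i) (d % k) k ⟩
    (toℕ i % k + d % k % k) % k   ≡⟨ cong (λ x → (toℕ i % k + x) % k) (m%n%n≡m%n d k) ⟩
    (toℕ i % k + d % k) % k       ≡⟨ %-distribˡ-+ (toℕ i) d k ⟨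
    (toℕ i + d) % k               ∎)
    where open ≡-Reasoning

  ⊕-assoc : ∀ i d e → i ⊕ d ⊕ e ≡ i ⊕ (d + e)
  ⊕-assoc i d e = ⊕-cong-% (i ⊕ d) e i (d + e) (begin
    (toℕ (i ⊕ d) + e) % k             ≡⟨ cong (λ x → (x + e) % k) (toℕ-⊕ i d) ⟩
    ((toℕ i + d) % k + e) % k         ≡⟨ %-distribˡ-+ ((toℕ i + d) % k) e k ⟩
    ((toℕ i + d) % k % k + e % k) % k ≡⟨ cong (λ x → (x + e % k) % k) (m%n%n≡m%n (toℕ i + d) k) ⟩
    ((toℕ i + d) % k + e % k) % k     ≡⟨ %-distribˡ-+ (toℕ i + d) e k ⟨
    (toℕ i + d + e) % k               ≡⟨ cong (_% k) (+-assoc (toℕ i) d e) ⟩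
    (toℕ i + (d + e)) % k             ∎)
    where open ≡-Reasoning

  ⊕-k : ∀ i → i ⊕ k ≡ i
  ⊕-k i = trans (⊕-cong-% i k i 0 (trans ([m+n]%n≡m%n (toℕ i) k) (cong (_% k) (sym (+-identityʳ (toℕ i))))))
                (⊕-identityʳ i)

  ⊕-complement : ∀ i → i ⊕ (k ∸ toℕ i) ≡ zero
  ⊕-complement i = trans (⊕-cong-% i (k ∸ toℕ i) zero 0 (trans (cong (_% k) (m+[n∸m]≡n (<⇒≤ (toℕ<n i)))) (n%n≡0 k)))
                         (⊕-identityʳ zero)

  ⊕-surjective : ∀ i j → ∃[ d ] (d < k × i ⊕ d ≡ j)
  ⊕-surjective i j = (k ∸ toℕ i + toℕ j) % k , m%n<n (k ∸ toℕ i + toℕ j) k , (begin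
    i ⊕ ((k ∸ toℕ i + toℕ j) % k) ≡⟨ ⊕-% i (k ∸ toℕ i + toℕ j) ⟩
    i ⊕ (k ∸ toℕ i + toℕ j)       ≡⟨ ⊕-assoc i (k ∸ toℕ i) (toℕ j) ⟨
    i ⊕ (k ∸ toℕ i) ⊕ toℕ j       ≡⟨ cong (_⊕ toℕ j) (⊕-complement i) ⟩
    zero ⊕ toℕ j                  ≡⟨ zero⊕toℕ j ⟩
    j                             ∎)
    where open ≡-Reasoning

  ⊕-≢ : ∀ i {d} → 0 < d → d < k → i ⊕ d ≢ i
  ⊕-≢ i {d} 0<d d<k i⊕d≡i = n≮n 0 (subst (0 <_) d≡0 0<d)
    where
    open ≡-Reasoning
    r = k ∸ toℕ i
    zero⊕d≡zero : zero ⊕ d ≡ zero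
    zero⊕d≡zero = begin
      zero ⊕ d      ≡⟨ cong (_⊕ d) (⊕-complement i) ⟨
      i ⊕ r ⊕ d     ≡⟨ ⊕-assoc i r d ⟩
      i ⊕ (r + d)   ≡⟨ cong (i ⊕_) (+-comm r d) ⟩
      i ⊕ (d + r)   ≡⟨ ⊕-assoc i d r ⟨
      i ⊕ d ⊕ r     ≡⟨ cong (_⊕ r) i⊕d≡i ⟩
      i ⊕ r         ≡⟨ ⊕-complement i ⟩
      zero          ∎
    d≡0 : d ≡ 0
    d≡0 = trans (sym (toℕ-zero⊕ d<k)) (cong toℕ zero⊕d≡zero)

  next-⊕ : ∀ i d → next (i ⊕ d) ≡ i ⊕ suc d
  next-⊕ i d = trans (⊕-assoc i d 1) (cong (i ⊕_) (+-comm d 1))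

  prev-next : ∀ i → prev (next i) ≡ i
  prev-next i = trans (⊕-assoc i 1 K) (⊕-k i)

  next-prev : ∀ i → next (prev i) ≡ i
  next-prev i = trans (next-⊕ i K) (⊕-k i)

hits : ∀ {n} → Fin n → Fin n × Fin n → ℕ
hits v p = ind (proj₁ p ≟ v) + ind (proj₂ p ≟ v)

hits-pos : ∀ {n} {v : Fin n} p → 1 ≤ hits v p → proj₁ p ≡ v ⊎ proj₂ p ≡ v
hits-pos {v = v} (a , b) 1≤hits with a ≟ v
... | yes a≡v = inj₁ a≡v
... | no _ = inj₂ (ind-pos (b ≟ v) 1≤hits)

hits-≥1 : ∀ {n} {v : Fin n} p → proj₁ p ≡ v ⊎ proj₂ p ≡ v → 1 ≤ hits v p
hits-≥1 {v = v} (a , b) a∨b≡v with a ≟ v | b ≟ v | a∨b≡v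
... | yes _ | _ | _ = s≤s z≤n
... | no _ | yes _ | _ = s≤s z≤n
... | no a≢v | no _ | inj₁ a≡v = ⊥-elim (a≢v a≡v)
... | no _ | no b≢v | inj₂ b≡v = ⊥-elim (b≢v b≡v)

degree-∑ : ∀ H v → degree H v ≡ ∑[ e < m H ] hits v (ends H e)
degree-∑ H v = sum-allFin (λ e → hits v (ends H e))

module _ {H : Graph} where

  Joins-sym : ∀ {e u w} → Joins H e u w → Joins H e w u
  Joins-sym (inj₁ (p , q)) = inj₂ (p , q)
  Joins-sym (inj₂ (p , q)) = inj₁ (p , q)

  Joins-≢ : ∀ {e u w} → Joins H e u w → w ≢ u
  Joins-≢ {e} (inj₁ (p , q)) w≡u = loopless H e (trans p (trans (sym w≡u) (sym q)))
  Joins-≢ {e} (inj₂ (p , q)) w≡u = loopless H e (trans p (trans w≡u (sym q)))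

  mapʷ : ∀ {P P' : Fin (n H) → Set} {a b} → (∀ v → P v → P' v) → Walk H P a b → Walk H P' a b
  mapʷ f (here p) = here (f _ p)
  mapʷ f (step e J p W) = step e J (f _ p) (mapʷ f W)

  infixr 5 _++ʷ_
  _++ʷ_ : ∀ {P a b c} → Walk H P a b → Walk H P b c → Walk H P a c
  here _ ++ʷ W' = W'
  step e J p W ++ʷ W' = step e J p (W ++ʷ W')

  startʷ : ∀ {P a b} → Walk H P a b → P a
  startʷ (here p) = p
  startʷ (step _ _ p _) = p

  reverseʷ : ∀ {P a b} → Walk H P a b → Walk H P b a
  reverseʷ (here p) = here p
  reverseʷ (step e J p W) = reverseʷ W ++ʷ step e (Joins-sym J) (startʷ W) (here p)

χ-abnormal : ℕ → ℕ
χ-abnormal u = ind (¬? (u ≟ℕ 3) ×-dec ¬? (u ≟ℕ 5))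

χ-abnormal≤1 : ∀ u → χ-abnormal u ≤ 1
χ-abnormal≤1 u = ind≤1 (¬? (u ≟ℕ 3) ×-dec ¬? (u ≟ℕ 5))

numAbnormal-∑ : ∀ H c → numAbnormal H c ≡ ∑[ e < m H ] χ-abnormal (unionSize H c e)
numAbnormal-∑ H c = sum-allFin (χ-abnormal ∘ unionSize H c)

S-cong : ∀ {H H' : Graph} {c : EdgeColoring5 H} {c' : EdgeColoring5 H'} {v v'} →
         (∀ col → ∃[ e ] (Incident H e v × c e ≡ col) → ∃[ e' ] (Incident H' e' v' × c' e' ≡ col)) →
         (∀ col → ∃[ e' ] (Incident H' e' v' × c' e' ≡ col) → ∃[ e ] (Incident H e v × c e ≡ col)) →
         S H c v ≡ S H' c' v'
S-cong {H} {H'} {c} {c'} {v} {v'} to from = tabulate-cong (λ col →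
  does-cong (any? (λ e → incident? H e v ×-dec (c e ≟ col))) (any? (λ e → incident? H' e v' ×-dec (c' e ≟ col)))
            (to col) (from col))
  where
  incident? : ∀ H e v → Dec (Incident H e v)
  incident? H e v = (proj₁ (ends H e) ≟ v) ⊎-dec (proj₂ (ends H e) ≟ v)

avoid₂ : ∀ {N} (a b : Fin (3 + N)) → ∃[ c ] (c ≢ a × c ≢ b)
avoid₂ zero zero = suc zero , (λ ()) , (λ ())
avoid₂ zero (suc zero) = suc (suc zero) , (λ ()) , (λ ())
avoid₂ zero (suc (suc _)) = suc zero , (λ ()) , (λ ())
avoid₂ (suc zero) zero = suc (suc zero) , (λ ()) , (λ ())
avoid₂ (suc zero) (suc _) = zero , (λ ()) , (λ ())
avoid₂ (suc (suc _)) zero = suc zero , (λ ()) , (λ ())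
avoid₂ (suc (suc _)) (suc _) = zero , (λ ()) , (λ ())

-- The ring of k = N + 3 copies of G − e₀, where e₀ = zero: copy j of e₀ joins u₀ in copy j to v₀
-- in copy next j.  Vertex w and edge e of copy j are combine j w and combine j e.
module Ring {n₀ m₀ : ℕ} (ends₀ : Fin (suc m₀) → Fin n₀ × Fin n₀)
            (loopless₀ : ∀ e → proj₁ (ends₀ e) ≢ proj₂ (ends₀ e)) (N : ℕ) where

  G : Graph
  G = record { n = n₀ ; m = suc m₀ ; ends = ends₀ ; loopless = loopless₀ }

  open Cyclic (suc (suc N)) public

  u₀ v₀ : Fin n₀
  u₀ = proj₁ (ends₀ zero)
  v₀ = proj₂ (ends₀ zero)

  u₀≢v₀ : u₀ ≢ v₀
  u₀≢v₀ = loopless₀ zero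

  OnE₀ : Fin n₀ → Set
  OnE₀ w = w ≡ u₀ ⊎ w ≡ v₀

  onE₀? : ∀ w → Dec (OnE₀ w)
  onE₀? w = (w ≟ u₀) ⊎-dec (w ≟ v₀)

  vert : Fin k → Fin n₀ → Fin (k * n₀)
  vert = combine

  edge : Fin k → Fin (suc m₀) → Fin (k * suc m₀)
  edge = combine

  vert-injective : ∀ j a j' a' → vert j a ≡ vert j' a' → j ≡ j' × a ≡ a'
  vert-injective = combine-injective

  ∀-vert : {P : Fin (k * n₀) → Set} → (∀ j w → P (vert j w)) → ∀ x → P x
  ∀-vert {P} P-vert x = subst P (combine-remQuot {k} n₀ x) (uncurry P-vert (remQuot n₀ x))

  ∀-edge : {P : Fin (k * suc m₀) → Set} → (∀ j e → P (edge j e)) → ∀ x → P x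
  ∀-edge {P} P-edge x = subst P (combine-remQuot {k} (suc m₀) x) (uncurry P-edge (remQuot (suc m₀) x))

  shift unshift : Fin (suc m₀) → Fin k → Fin k
  shift zero = next
  shift (suc _) = id
  unshift zero = prev
  unshift (suc _) = id

  shift-unshift : ∀ e i → shift e (unshift e i) ≡ i
  shift-unshift zero = next-prev
  shift-unshift (suc _) _ = refl

  shift-≡ : ∀ e {i j} → shift e j ≡ i → j ≡ unshift e i
  shift-≡ zero {j = j} eq = trans (sym (prev-next j)) (cong prev eq)
  shift-≡ (suc _) eq = eq

  copyEnds : Fin k → Fin (suc m₀) → Fin (k * n₀) × Fin (k * n₀)
  copyEnds j e = vert j (proj₁ (ends₀ e)) , vert (shift e j) (proj₂ (ends₀ e))

  ring : Graph
  ring = record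
    { n = k * n₀
    ; m = k * suc m₀
    ; ends = uncurry copyEnds ∘ remQuot (suc m₀)
    ; loopless = uncurry copyEnds-loopless ∘ remQuot (suc m₀)
    }
    where
    copyEnds-loopless : ∀ j e → proj₁ (copyEnds j e) ≢ proj₂ (copyEnds j e)
    copyEnds-loopless j e eq = loopless₀ e (proj₂ (vert-injective j _ (shift e j) _ eq))

  ends-edge : ∀ j e → ends ring (edge j e) ≡ copyEnds j e
  ends-edge j e = cong (uncurry copyEnds) (remQuot-combine j e)

  joins-edge : ∀ j e {x y} →
               (proj₁ (copyEnds j e) ≡ x × proj₂ (copyEnds j e) ≡ y) ⊎ (proj₁ (copyEnds j e) ≡ y × proj₂ (copyEnds j e) ≡ x) →
               Joins ring (edge j e) x y
  joins-edge j e {x} {y} =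
    subst (λ p → (proj₁ p ≡ x × proj₂ p ≡ y) ⊎ (proj₁ p ≡ y × proj₂ p ≡ x)) (sym (ends-edge j e))

  incident-edge : ∀ j e {x} → proj₁ (copyEnds j e) ≡ x ⊎ proj₂ (copyEnds j e) ≡ x → Incident ring (edge j e) x
  incident-edge j e {x} = subst (λ p → proj₁ p ≡ x ⊎ proj₂ p ≡ x) (sym (ends-edge j e))

  edge-incident : ∀ j e {x} → Incident ring (edge j e) x → proj₁ (copyEnds j e) ≡ x ⊎ proj₂ (copyEnds j e) ≡ x
  edge-incident j e {x} = subst (λ p → proj₁ p ≡ x ⊎ proj₂ p ≡ x) (ends-edge j e)

  ∑-vert : ∀ (σ : Fin k → Fin k) {i τ} → (∀ {j} → σ j ≡ i → j ≡ τ) → σ τ ≡ i →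
           ∀ a w → ∑[ j < k ] ind (vert (σ j) a ≟ vert i w) ≡ ind (a ≟ w)
  ∑-vert σ {i} {τ} σ≡⇒ στ≡i a w = begin
    ∑[ j < k ] ind (vert (σ j) a ≟ vert i w)       ≡⟨ ∑-cong ind-vert ⟩
    ∑[ j < k ] (ind (j ≟ τ) * ind (a ≟ w))         ≡⟨ *-distribʳ-sum (ind (a ≟ w)) (λ j → ind (j ≟ τ)) ⟨
    ∑[ j < k ] ind (j ≟ τ) * ind (a ≟ w)           ≡⟨ cong (_* ind (a ≟ w)) (∑-ind-≡ τ) ⟩
    1 * ind (a ≟ w)                                ≡⟨ +-identityʳ (ind (a ≟ w)) ⟩
    ind (a ≟ w)                                    ∎
    where
    open ≡-Reasoning
    to : ∀ {j} → vert (σ j) a ≡ vert i w → j ≡ τ × a ≡ w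
    to {j} eq = σ≡⇒ (proj₁ (vert-injective (σ j) a i w eq)) , proj₂ (vert-injective (σ j) a i w eq)
    from : ∀ {j} → j ≡ τ × a ≡ w → vert (σ j) a ≡ vert i w
    from (refl , refl) = cong (λ j → vert j a) στ≡i
    ind-vert : ∀ j → ind (vert (σ j) a ≟ vert i w) ≡ ind (j ≟ τ) * ind (a ≟ w)
    ind-vert j = trans (ind-cong (vert (σ j) a ≟ vert i w) ((j ≟ τ) ×-dec (a ≟ w)) to from) (ind-× (j ≟ τ) (a ≟ w))

  ∑-copies-hits : ∀ i w e → ∑[ j < k ] hits (vert i w) (copyEnds j e) ≡ hits w (ends₀ e)
  ∑-copies-hits i w e =
    trans (∑-distrib-+ (λ j → ind (vert j a ≟ vert i w)) (λ j → ind (vert (shift e j) b ≟ vert i w)))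
    (cong₂ _+_ (∑-vert id {i} id refl a w)
               (∑-vert (shift e) (shift-≡ e) (shift-unshift e i) b w))
    where
    a = proj₁ (ends₀ e)
    b = proj₂ (ends₀ e)

  degree-vert : ∀ i w → degree ring (vert i w) ≡ degree G w
  degree-vert i w = begin
    degree ring (vert i w)                                              ≡⟨ degree-∑ ring (vert i w) ⟩
    ∑[ x < k * suc m₀ ] hits (vert i w) (ends ring x)                   ≡⟨ ∑-combine k (suc m₀) (hits (vert i w) ∘ ends ring) ⟩
    ∑[ j < k ] ∑[ e < suc m₀ ] hits (vert i w) (ends ring (edge j e))   ≡⟨ ∑-cong (λ j → ∑-cong (λ e → cong (hits (vert i w)) (ends-edge j e))) ⟩
    ∑[ j < k ] ∑[ e < suc m₀ ] hits (vert i w) (copyEnds j e)           ≡⟨ ∑-comm (λ j e → hits (vert i w) (copyEnds j e)) ⟩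
    ∑[ e < suc m₀ ] ∑[ j < k ] hits (vert i w) (copyEnds j e)           ≡⟨ ∑-cong (∑-copies-hits i w) ⟩
    ∑[ e < suc m₀ ] hits w (ends₀ e)                                    ≡⟨ degree-∑ G w ⟨
    degree G w                                                          ∎
    where open ≡-Reasoning

  cubic-ring : Cubic G → Cubic ring
  cubic-ring cubic = ∀-vert (λ i w → trans (degree-vert i w) (cubic w))

  lift-Joins-suc : ∀ j f {a b} → Joins G (suc f) a b → Joins ring (edge j (suc f)) (vert j a) (vert j b)
  lift-Joins-suc j f (inj₁ (p , q)) = joins-edge j (suc f) (inj₁ (cong (vert j) p , cong (vert j) q))
  lift-Joins-suc j f (inj₂ (p , q)) = joins-edge j (suc f) (inj₂ (cong (vert j) p , cong (vert j) q))

  lift-Joins : ∀ j e {a b} → Joins G e a b → ¬ OnE₀ a → Joins ring (edge j e) (vert j a) (vert j b)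
  lift-Joins j zero (inj₁ (p , _)) a∉E₀ = ⊥-elim (a∉E₀ (inj₁ (sym p)))
  lift-Joins j zero (inj₂ (_ , q)) a∉E₀ = ⊥-elim (a∉E₀ (inj₂ (sym q)))
  lift-Joins j (suc f) J _ = lift-Joins-suc j f J

  -- Up to its first visit of u₀ or v₀, a walk of G does not use e₀, so it has a copy in copy j.
  lift-until-E₀ : ∀ j {P Q} → (∀ w → P w → Q (vert j w)) → ∀ {a b} → Walk G P a b → OnE₀ b →
                  ∃[ t ] (OnE₀ t × P t × Walk ring Q (vert j a) (vert j t))
  lift-until-E₀ j PQ (here p) b∈E₀ = _ , b∈E₀ , p , here (PQ _ p)
  lift-until-E₀ j PQ {a} (step e J p W) b∈E₀ with onE₀? a
  ... | yes a∈E₀ = a , a∈E₀ , p , here (PQ a p)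
  ... | no a∉E₀ with lift-until-E₀ j PQ W b∈E₀
  ...   | t , t∈E₀ , pt , W' = t , t∈E₀ , pt , step (edge j e) (lift-Joins j e J a∉E₀) (PQ a p) W'

  hits-e₀-u₀ : hits u₀ (ends₀ zero) ≡ 1
  hits-e₀-u₀ = cong₂ _+_ (ind-true (u₀ ≟ u₀) refl) (ind-false (v₀ ≟ u₀) (u₀≢v₀ ∘ sym))

  hits-e₀-v₀ : hits v₀ (ends₀ zero) ≡ 1
  hits-e₀-v₀ = cong₂ _+_ (ind-false (u₀ ≟ v₀) u₀≢v₀) (ind-true (v₀ ≟ v₀) refl)

  ∑-hits-off-e₀ : ∀ {v} → degree G v ≡ 3 → hits v (ends₀ zero) ≡ 1 → ∑[ f < m₀ ] hits v (ends₀ (suc f)) ≡ 2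
  ∑-hits-off-e₀ {v} deg h₀ =
    +-cancelˡ-≡ 1 _ 2 (trans (cong (_+ ∑[ f < m₀ ] hits v (ends₀ (suc f))) (sym h₀)) (trans (sym (degree-∑ G v)) deg))

  module Connectivity (cubic : Cubic G) (two : TwoConnected G) where

    edge-at-u₀ : ∃[ f ] ∃[ w ] Joins G (suc f) u₀ w
    edge-at-u₀ with ∑-pos (λ f → hits u₀ (ends₀ (suc f))) (subst (1 ≤_) (sym (∑-hits-off-e₀ (cubic u₀) hits-e₀-u₀)) (s≤s z≤n))
    ... | f , 1≤hits with hits-pos (ends₀ (suc f)) 1≤hits
    ...   | inj₁ p = _ , _ , inj₁ (p , refl)
    ...   | inj₂ p = _ , _ , inj₂ (refl , p)

    avoiding-u₀ : ∀ {Q} j → (∀ w → Q (vert j w)) → ∀ w → w ≢ u₀ → Walk ring Q (vert j w) (vert j v₀)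
    avoiding-u₀ j Qj w w≢u₀ with lift-until-E₀ j (λ z _ → Qj z) (proj₂ two u₀ w v₀ w≢u₀ (u₀≢v₀ ∘ sym)) (inj₂ refl)
    ... | _ , inj₁ refl , u₀≢u₀ , _ = ⊥-elim (u₀≢u₀ refl)
    ... | _ , inj₂ refl , _ , W = W

    to-v₀ : ∀ {Q} j → (∀ w → Q (vert j w)) → ∀ w → Walk ring Q (vert j w) (vert j v₀)
    to-v₀ j Qj w with w ≟ u₀ | edge-at-u₀
    ... | no w≢u₀ | _ = avoiding-u₀ j Qj w w≢u₀
    ... | yes refl | f , w' , J = step (edge j (suc f)) (lift-Joins-suc j f J) (Qj u₀) (avoiding-u₀ j Qj w' (Joins-≢ {H = G} J))

    -- Every vertex of ring − vert i y reaches v₀ in copy next i: copies j ≢ i go around the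
    -- ring, and copy i is left through u₀ or v₀, whichever differs from y.
    module Avoiding (i : Fin k) (y : Fin n₀) where

      Q : Fin (k * n₀) → Set
      Q x = x ≢ vert i y

      Q-other : ∀ {j} → j ≢ i → ∀ w → Q (vert j w)
      Q-other {j} j≢i w eq = j≢i (proj₁ (vert-injective j w i y eq))

      Q-same : ∀ w → w ≢ y → Q (vert i w)
      Q-same w w≢y eq = w≢y (proj₂ (vert-injective i w i y eq))

      hub : Fin (k * n₀)
      hub = vert (next i) v₀

      -- From copy i ⊕ suc d, walk back along the ring through copies i ⊕ d, …, i ⊕ 1.
      around : ∀ d → suc d < k → ∀ w → Walk ring Q (vert (i ⊕ suc d) w) hub
      around zero 1<k w = to-v₀ (i ⊕ 1) (Q-other (⊕-≢ i z<s 1<k)) w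
      around (suc d) d+2<k w =
        to-v₀ (i ⊕ suc (suc d)) Q-here w
        ++ʷ step (edge (i ⊕ suc d) zero) link (Q-here v₀) (around d (<-trans (n<1+n (suc d)) d+2<k) u₀)
        where
        Q-here = Q-other (⊕-≢ i z<s d+2<k)
        link : Joins ring (edge (i ⊕ suc d) zero) (vert (i ⊕ suc (suc d)) v₀) (vert (i ⊕ suc d) u₀)
        link = joins-edge (i ⊕ suc d) zero (inj₂ (refl , cong (λ j → vert j v₀) (next-⊕ i (suc d))))

      exit : ∃[ t ] (OnE₀ t × t ≢ y)
      exit with u₀ ≟ y
      ... | yes refl = v₀ , inj₂ refl , u₀≢v₀ ∘ sym
      ... | no u₀≢y = u₀ , inj₁ refl , u₀≢y

      within : ∀ w → w ≢ y → Walk ring Q (vert i w) hub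
      within w w≢y with exit
      ... | t , t∈E₀ , t≢y with lift-until-E₀ i Q-same (proj₂ two y w t w≢y t≢y) t∈E₀
      ...   | _ , inj₁ refl , u₀≢y , W =
                W ++ʷ step (edge i zero) (joins-edge i zero (inj₁ (refl , refl))) (Q-same u₀ u₀≢y)
                        (here (Q-other (⊕-≢ i z<s (s≤s (s≤s z≤n))) v₀))
      ...   | _ , inj₂ refl , v₀≢y , W =
                W ++ʷ step (edge (prev i) zero) (joins-edge (prev i) zero (inj₂ (refl , cong (λ j → vert j v₀) (next-prev i))))
                        (Q-same v₀ v₀≢y) (around (suc N) ≤-refl u₀)

      to-hub : ∀ x → Q x → Walk ring Q x hub
      to-hub = ∀-vert to-hub-vert
        where
        to-hub-vert : ∀ j w → Q (vert j w) → Walk ring Q (vert j w) hub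
        to-hub-vert j w q with j ≟ i | ⊕-surjective i j
        ... | yes refl | _ = within w (q ∘ cong (vert i))
        ... | no j≢i | zero , _ , i⊕0≡j = ⊥-elim (j≢i (trans (sym i⊕0≡j) (⊕-identityʳ i)))
        ... | no _ | suc d , d<k , refl = around d d<k w

      connected-without : ConnectedWithout ring (vert i y)
      connected-without a b qa qb = to-hub a qa ++ʷ reverseʷ (to-hub b qb)

    connected-ring : Connected ring
    connected-ring = ∀-vert (λ j w → ∀-vert (λ j' w' → via-third j w j' w'))
      where
      via-third : ∀ j w j' w' → Walk ring (λ _ → ⊤) (vert j w) (vert j' w')
      via-third j w j' w' with avoid₂ j j'
      ... | c , c≢j , c≢j' = mapʷ (λ _ _ → tt)
        (Avoiding.connected-without c u₀ (vert j w) (vert j' w')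
                                    (Avoiding.Q-other c u₀ (c≢j ∘ sym) w) (Avoiding.Q-other c u₀ (c≢j' ∘ sym) w'))

    two-connected-ring : TwoConnected ring
    two-connected-ring = connected-ring , ∀-vert Avoiding.connected-without

module Recolouring {n₀ m₀ : ℕ} (ends₀ : Fin (suc m₀) → Fin n₀ × Fin n₀)
                   (loopless₀ : ∀ e → proj₁ (ends₀ e) ≢ proj₂ (ends₀ e)) (N : ℕ) where

  open Ring ends₀ loopless₀ N

  Interior : Fin (suc m₀) → Set
  Interior e = ¬ OnE₀ (proj₁ (ends₀ e)) × ¬ OnE₀ (proj₂ (ends₀ e))

  interior? : ∀ e → Dec (Interior e)
  interior? e = ¬? (onE₀? (proj₁ (ends₀ e))) ×-dec ¬? (onE₀? (proj₂ (ends₀ e)))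

  CleanCopy : (Fin (k * suc m₀) → ℕ) → Fin k → Set
  CleanCopy χ j = ∀ e → Interior e → χ (edge j e) ≡ 0

  Dirty : (Fin (k * suc m₀) → ℕ) → Fin k → Set
  Dirty χ j = ∃[ e ] (Interior e × 1 ≤ χ (edge j e))

  dirty? : ∀ χ j → Dec (Dirty χ j)
  dirty? χ j = any? (λ e → interior? e ×-dec (1 ≤? χ (edge j e)))

  ¬Dirty⇒Clean : ∀ χ {j} → ¬ Dirty χ j → CleanCopy χ j
  ¬Dirty⇒Clean _ ¬dirty e int = n<1⇒n≡0 (≰⇒> (λ 1≤χ → ¬dirty (e , int , 1≤χ)))

  clean-copy : ∀ χ → sum χ < k → ∃[ i ] CleanCopy χ i
  clean-copy χ ∑χ<k = decide (all? (dirty? χ))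
    where
    decide : Dec (∀ j → Dirty χ j) → ∃[ i ] CleanCopy χ i
    decide (yes all-dirty) = ⊥-elim (<⇒≱ ∑χ<k (injection⇒≤∑ χ φ φ-injective χ-φ))
      where
      φ : Fin k → Fin (k * suc m₀)
      φ j = edge j (proj₁ (all-dirty j))
      φ-injective : ∀ {j j'} → φ j ≡ φ j' → j ≡ j'
      φ-injective {j} {j'} = combine-injectiveˡ j _ j' _
      χ-φ : ∀ j → 1 ≤ χ (φ j)
      χ-φ j = proj₂ (proj₂ (all-dirty j))
    decide (no ¬all-dirty) = let i , ¬dirty = ¬∀⟶∃¬ k (Dirty χ) (dirty? χ) ¬all-dirty in i , ¬Dirty⇒Clean χ {i} ¬dirty

  module FromCleanCopy (cubic : Cubic G) (C : EdgeColoring5 ring) (C-proper : Proper ring C)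
                  (i : Fin k) (clean : CleanCopy (χ-abnormal ∘ unionSize ring C) i) where

    touches : Fin (suc m₀) → ℕ
    touches e = hits u₀ (ends₀ e) + hits v₀ (ends₀ e)

    ∑-touches-off-e₀ : ∑[ f < m₀ ] touches (suc f) ≡ 4
    ∑-touches-off-e₀ = trans (∑-distrib-+ (λ f → hits u₀ (ends₀ (suc f))) (λ f → hits v₀ (ends₀ (suc f))))
      (cong₂ _+_ (∑-hits-off-e₀ (cubic u₀) hits-e₀-u₀) (∑-hits-off-e₀ (cubic v₀) hits-e₀-v₀))

    on-E₀-touches : ∀ e {w} → OnE₀ w → proj₁ (ends₀ e) ≡ w ⊎ proj₂ (ends₀ e) ≡ w → 1 ≤ touches e
    on-E₀-touches e (inj₁ refl) I = ≤-trans (hits-≥1 (ends₀ e) I) (m≤m+n _ (hits v₀ (ends₀ e)))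
    on-E₀-touches e (inj₂ refl) I = ≤-trans (hits-≥1 (ends₀ e) I) (m≤n+m _ (hits u₀ (ends₀ e)))

    ¬Interior→touches : ∀ e → ¬ Interior e → 1 ≤ touches e
    ¬Interior→touches e ¬int = decide (onE₀? (proj₁ (ends₀ e))) (onE₀? (proj₂ (ends₀ e)))
      where
      decide : Dec (OnE₀ (proj₁ (ends₀ e))) → Dec (OnE₀ (proj₂ (ends₀ e))) → 1 ≤ touches e
      decide (yes a∈E₀) _ = on-E₀-touches e a∈E₀ (inj₁ refl)
      decide (no _) (yes b∈E₀) = on-E₀-touches e b∈E₀ (inj₂ refl)
      decide (no a∉E₀) (no b∉E₀) = ⊥-elim (¬int (a∉E₀ , b∉E₀))

    Incident→¬Interior : ∀ {e w} → OnE₀ w → Incident G e w → ¬ Interior e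
    Incident→¬Interior w∈E₀ (inj₁ refl) (a∉E₀ , _) = a∉E₀ w∈E₀
    Incident→¬Interior w∈E₀ (inj₂ refl) (_ , b∉E₀) = b∉E₀ w∈E₀

    Incident-e₀ : ∀ {w} → Incident G zero w → OnE₀ w
    Incident-e₀ (inj₁ p) = inj₁ (sym p)
    Incident-e₀ (inj₂ q) = inj₂ (sym q)

    lift-Incident : ∀ f {w} → Incident G (suc f) w → Incident ring (edge i (suc f)) (vert i w)
    lift-Incident f (inj₁ p) = incident-edge i (suc f) (inj₁ (cong (vert i) p))
    lift-Incident f (inj₂ q) = incident-edge i (suc f) (inj₂ (cong (vert i) q))

    Cᵢ : Fin m₀ → Fin 5
    Cᵢ f = C (edge i (suc f))

    Used : Fin 5 → Set
    Used d = ∃[ f ] (¬ Interior (suc f) × Cᵢ f ≡ d)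

    used? : ∀ d → Dec (Used d)
    used? d = any? (λ f → ¬? (interior? (suc f)) ×-dec (Cᵢ f ≟ d))

    -- The at most four edges other than e₀ at u₀ or v₀ cannot use all five colours.
    free-colour : ∃[ d ] ¬ Used d
    free-colour = decide (any? (λ d → ¬? (used? d)))
      where
      decide : Dec (∃[ d ] ¬ Used d) → ∃[ d ] ¬ Used d
      decide (yes unused) = unused
      decide (no ¬∃unused) = ⊥-elim (5≰4 (subst (5 ≤_) ∑-touches-off-e₀ (injection⇒≤∑ (touches ∘ suc) φ φ-injective touches-φ)))
        where
        used : ∀ d → Used d
        used d = decidable-stable (used? d) (λ ¬used → ¬∃unused (d , ¬used))
        φ : Fin 5 → Fin m₀
        φ d = proj₁ (used d)
        φ-injective : ∀ {d d'} → φ d ≡ φ d' → d ≡ d'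
        φ-injective {d} {d'} eq = trans (sym (proj₂ (proj₂ (used d)))) (trans (cong Cᵢ eq) (proj₂ (proj₂ (used d'))))
        touches-φ : ∀ d → 1 ≤ touches (suc (φ d))
        touches-φ d = ¬Interior→touches (suc (φ d)) (proj₁ (proj₂ (used d)))
        5≰4 : ¬ 5 ≤ 4
        5≰4 (s≤s (s≤s (s≤s (s≤s ()))))

    recoloured : EdgeColoring5 G
    recoloured zero = proj₁ free-colour
    recoloured (suc f) = Cᵢ f

    recoloured-proper : Proper G recoloured
    recoloured-proper zero zero _ e≢f _ _ = ⊥-elim (e≢f refl)
    recoloured-proper zero (suc f) _ _ I₀ I eq = proj₂ free-colour (f , Incident→¬Interior (Incident-e₀ I₀) I , sym eq)
    recoloured-proper (suc f) zero _ _ I I₀ eq = proj₂ free-colour (f , Incident→¬Interior (Incident-e₀ I₀) I , eq)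
    recoloured-proper (suc e) (suc f) w e≢f Ie If =
      C-proper (edge i (suc e)) (edge i (suc f)) (vert i w)
               (e≢f ∘ proj₂ ∘ combine-injective i (suc e) i (suc f)) (lift-Incident e Ie) (lift-Incident f If)

    S-off-E₀ : ∀ w → ¬ OnE₀ w → S G recoloured w ≡ S ring C (vert i w)
    S-off-E₀ w w∉E₀ = S-cong {G} {ring} {recoloured} {C} {w} {vert i w} to from
      where
      to : ∀ col → ∃[ e ] (Incident G e w × recoloured e ≡ col) → ∃[ x ] (Incident ring x (vert i w) × C x ≡ col)
      to col (zero , I , _) = ⊥-elim (w∉E₀ (Incident-e₀ I))
      to col (suc f , I , eq) = edge i (suc f) , lift-Incident f I , eq
      from-copy : ∀ col j e → proj₁ (copyEnds j e) ≡ vert i w ⊎ proj₂ (copyEnds j e) ≡ vert i w →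
                  C (edge j e) ≡ col → ∃[ e' ] (Incident G e' w × recoloured e' ≡ col)
      from-copy col j zero (inj₁ p) _ = ⊥-elim (w∉E₀ (inj₁ (sym (proj₂ (vert-injective j u₀ i w p)))))
      from-copy col j zero (inj₂ q) _ = ⊥-elim (w∉E₀ (inj₂ (sym (proj₂ (vert-injective (next j) v₀ i w q)))))
      from-copy col j (suc f) (inj₁ p) eq =
        suc f , inj₁ (proj₂ (vert-injective j _ i w p)) , subst (λ j → C (edge j (suc f)) ≡ col) (proj₁ (vert-injective j _ i w p)) eq
      from-copy col j (suc f) (inj₂ q) eq =
        suc f , inj₂ (proj₂ (vert-injective j _ i w q)) , subst (λ j → C (edge j (suc f)) ≡ col) (proj₁ (vert-injective j _ i w q)) eq
      from : ∀ col → ∃[ x ] (Incident ring x (vert i w) × C x ≡ col) → ∃[ e ] (Incident G e w × recoloured e ≡ col)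
      from col (x , I , eq) =
        ∀-edge {λ x → Incident ring x (vert i w) → C x ≡ col → ∃[ e ] (Incident G e w × recoloured e ≡ col)}
               (λ j e I → from-copy col j e (edge-incident j e I)) x I eq

    unionSize-interior : ∀ f → Interior (suc f) → unionSize G recoloured (suc f) ≡ unionSize ring C (edge i (suc f))
    unionSize-interior f (a∉E₀ , b∉E₀) = begin
      ∣ S G recoloured a ∪ S G recoloured b ∣              ≡⟨ cong₂ (λ s t → ∣ s ∪ t ∣) (S-off-E₀ a a∉E₀) (S-off-E₀ b b∉E₀) ⟩
      ∣ S ring C (vert i a) ∪ S ring C (vert i b) ∣        ≡⟨ cong (λ p → ∣ S ring C (proj₁ p) ∪ S ring C (proj₂ p) ∣) (ends-edge i (suc f)) ⟨
      unionSize ring C (edge i (suc f))                   ∎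
      where
      open ≡-Reasoning
      a = proj₁ (ends₀ (suc f))
      b = proj₂ (ends₀ (suc f))

    χ-abnormal≤touches : ∀ f → χ-abnormal (unionSize G recoloured (suc f)) ≤ touches (suc f)
    χ-abnormal≤touches f = decide (interior? (suc f))
      where
      decide : Dec (Interior (suc f)) → χ-abnormal (unionSize G recoloured (suc f)) ≤ touches (suc f)
      decide (yes int) = ≤-trans (≤-reflexive (trans (cong χ-abnormal (unionSize-interior f int)) (clean (suc f) int))) z≤n
      decide (no ¬int) = ≤-trans (χ-abnormal≤1 (unionSize G recoloured (suc f))) (¬Interior→touches (suc f) ¬int)

    recoloured-abnormal≤5 : numAbnormal G recoloured ≤ 5
    recoloured-abnormal≤5 = begin
      numAbnormal G recoloured                     ≡⟨ numAbnormal-∑ G recoloured ⟩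
      χ zero + ∑[ f < m₀ ] χ (suc f)               ≤⟨ +-mono-≤ (χ-abnormal≤1 (unionSize G recoloured zero)) (∑-mono-≤ χ-abnormal≤touches) ⟩
      1 + ∑[ f < m₀ ] touches (suc f)              ≡⟨ cong suc ∑-touches-off-e₀ ⟩
      5                                            ∎
      where
      open ≤-Reasoning
      χ = χ-abnormal ∘ unionSize G recoloured

constant-sublinear : ∀ c → Sublinear (λ _ → c)
constant-sublinear c ε⁻¹ = suc ε⁻¹ * c , λ _ le → le

-- f(x) ≤ x/(n + 2) for large x, and x := (k + 1)(n + 1) < (k + 1)(n + 2).
sublinear-below-copies : ∀ {f} → Sublinear f → ∀ n → ∃[ N ] (∀ k → N ≤ k → f (suc k * suc n) < suc k)
sublinear-below-copies {f} sublinear n = N , below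
  where
  N = proj₁ (sublinear (suc n))
  below : ∀ k → N ≤ k → f (suc k * suc n) < suc k
  below k N≤k = ≰⇒> λ 1+k≤fx → <⇒≱ x<[n+2][k+1] (≤-trans (*-monoʳ-≤ (suc (suc n)) 1+k≤fx) (proj₂ (sublinear (suc n)) x N≤x))
    where
    x = suc k * suc n
    N≤x : N ≤ x
    N≤x = ≤-trans N≤k (≤-trans (n≤1+n k) (m≤m*n (suc k) (suc n)))
    x<[n+2][k+1] : x < suc (suc n) * suc k
    x<[n+2][k+1] = subst (x <_) (*-comm (suc k) (suc (suc n))) (*-monoʳ-< (suc k) (n<1+n (suc n)))

FiveAbnormal : Set
FiveAbnormal = (G : Graph) → Cubic G → TwoConnected G → ∃[ c ] (Proper G c × numAbnormal G c ≤ 5)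

sublinear⇒five : ∀ {f} → Sublinear f →
                 ((G : Graph) → Cubic G → TwoConnected G → ∃[ c ] (Proper G c × numAbnormal G c ≤ f (∣V∣ G))) →
                 FiveAbnormal
sublinear⇒five _ _ record { m = zero } _ _ = (λ ()) , (λ ()) , z≤n
sublinear⇒five _ _ record { n = zero ; m = suc _ ; ends = ends₀ } _ _ with proj₁ (ends₀ zero)
... | ()
sublinear⇒five sublinear bound record { n = suc n₀ ; m = suc m₀ ; ends = ends₀ ; loopless = loopless₀ } cubic two =
  recoloured , recoloured-proper , recoloured-abnormal≤5
  where
  copies = sublinear-below-copies sublinear n₀
  N = proj₁ copies
  open Ring ends₀ loopless₀ N
  open Recolouring ends₀ loopless₀ N
  coloured-ring = bound ring (cubic-ring cubic) (Connectivity.two-connected-ring cubic two)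
  C = proj₁ coloured-ring
  abnormal<k : numAbnormal ring C < k
  abnormal<k = ≤-<-trans (proj₂ (proj₂ coloured-ring)) (proj₂ copies (suc (suc N)) (≤-trans (n≤1+n N) (n≤1+n (suc N))))
  clean = clean-copy (χ-abnormal ∘ unionSize ring C) (subst (_< k) (numAbnormal-∑ ring C) abnormal<k)
  open FromCleanCopy cubic C (proj₁ (proj₂ coloured-ring)) (proj₁ clean) (proj₂ clean)

theorem2 : ((G : Graph) → Cubic G → TwoConnected G →
    ∃[ c ] (Proper G c × numAbnormal G c ≤ 5))
    ⇔ (∃[ f ] (Sublinear f × ((G : Graph) → Cubic G → TwoConnected G →
    ∃[ c ] (Proper G c × numAbnormal G c ≤ f (∣V∣ G)))))
theorem2 = mk⇔ (λ five → (λ _ → 5) , constant-sublinear 5 , five) (λ (_ , sublinear , bound) → sublinear⇒five sublinear bound)
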